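{- Let $K_0$ be an infinite field, $K$ a field extending $K_0$, and $\operatorname{val}_1,\ldots,\operatorname{val}_m$ valuations on $K$ trivial on $K_0$. Then every tuple $\vec{x}\in K^n$ can be scrambled by an element of $GL_n(K_0)$, i.e., there is $\mu\in GL_n(K_0)$ such that, writing $\vec{y}=\mu\cdot\vec{x}$, we have $\operatorname{val}_i(y_1)=\cdots=\operatorname{val}_i(y_n)$ for every $i\le m$. -}

module Defs where

open import Level using (Level; _⊔_) renaming (suc to lsuc)
open import Data.Nat using (ℕ)
open import Data.Fin using (Fin) renaming (zero to fzero; suc to fsuc)
open import Data.Maybe using (Maybe; just; nothing)
open import Data.Product using (Σ; ∃; _×_; _,_)
open import Data.Sum using (_⊎_)
open import Relation.Nullary using (¬_)
open import Relation.Binary.PropositionalEquality using (_≡_)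
open import Relation.Binary.Structures using (IsTotalOrder)
open import Algebra.Bundles using (CommutativeRing)
open import Algebra.Structures using (IsAbelianGroup)
open import Algebra.Morphism.Structures using (IsRingHomomorphism)

record Field (c ℓ : Level) : Set (lsuc (c ⊔ ℓ)) where
  field
    commutativeRing : CommutativeRing c ℓ
  open CommutativeRing commutativeRing public
  field
    0≉1     : ¬ (0# ≈ 1#)
    inverse : ∀ x → ¬ (x ≈ 0#) → ∃ λ y → (x * y) ≈ 1#

Infinite : ∀ {c ℓ} → Field c ℓ → Set (c ⊔ ℓ)
Infinite K = Σ (ℕ → Carrier) λ f → ∀ i j → f i ≈ f j → i ≡ j
  where open Field K

-- K is a field extending K₀: a ring homomorphism ι : K₀ → K
-- (field homomorphisms are automatically injective).
record Extension {c₀ ℓ₀ c ℓ} (K₀ : Field c₀ ℓ₀) (K : Field c ℓ)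
       : Set (c₀ ⊔ ℓ₀ ⊔ c ⊔ ℓ) where
  private
    module K₀ = Field K₀
    module K  = Field K
  field
    ι      : K₀.Carrier → K.Carrier
    isHom  : IsRingHomomorphism K₀.rawRing K.rawRing ι

record OrderedAbelianGroup (c ℓ₁ ℓ₂ : Level) : Set (lsuc (c ⊔ ℓ₁ ⊔ ℓ₂)) where
  infixl 6 _+_
  infix  4 _≈_ _≤_
  field
    Carrier        : Set c
    _≈_            : Carrier → Carrier → Set ℓ₁
    _≤_            : Carrier → Carrier → Set ℓ₂
    _+_            : Carrier → Carrier → Carrier
    0#             : Carrier
    -_             : Carrier → Carrier
    isAbelianGroup : IsAbelianGroup _≈_ _+_ 0# -_
    isTotalOrder   : IsTotalOrder _≈_ _≤_
    +-monoˡ-≤      : ∀ {a b} z → a ≤ b → (a + z) ≤ (b + z)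

module Extended {c ℓ₁ ℓ₂} (Γ : OrderedAbelianGroup c ℓ₁ ℓ₂) where
  open OrderedAbelianGroup Γ

  Γ∞ : Set c
  Γ∞ = Maybe Carrier

  ∞ : Γ∞
  ∞ = nothing

  data _≈∞_ : Γ∞ → Γ∞ → Set (c ⊔ ℓ₁) where
    ∞≈∞ : nothing ≈∞ nothing
    fin : ∀ {a b} → a ≈ b → just a ≈∞ just b

  data _≤∞_ : Γ∞ → Γ∞ → Set (c ⊔ ℓ₂) where
    ≤∞-top : ∀ {a} → a ≤∞ nothing
    fin    : ∀ {a b} → a ≤ b → just a ≤∞ just b

  _+∞_ : Γ∞ → Γ∞ → Γ∞
  just a  +∞ just b  = just (a + b)
  _       +∞ _       = nothing

record Valuation {c ℓ c' ℓ₁ ℓ₂} (K : Field c ℓ)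
       (Γ : OrderedAbelianGroup c' ℓ₁ ℓ₂) : Set (c ⊔ ℓ ⊔ c' ⊔ ℓ₁ ⊔ ℓ₂) where
  open Field K
  open Extended Γ
  field
    v          : Carrier → Γ∞
    v-cong     : ∀ {x y} → x ≈ y → v x ≈∞ v y
    v-∞⇒0      : ∀ x → v x ≡ ∞ → x ≈ 0#
    v-0        : v 0# ≡ ∞
    v-*        : ∀ x y → v (x * y) ≈∞ (v x +∞ v y)
    v-+        : ∀ x y → (v x ≤∞ v (x + y)) ⊎ (v y ≤∞ v (x + y))

TrivialOn : ∀ {c₀ ℓ₀ c ℓ c' ℓ₁ ℓ₂} {K₀ : Field c₀ ℓ₀} {K : Field c ℓ}
            {Γ : OrderedAbelianGroup c' ℓ₁ ℓ₂} →
            Extension K₀ K → Valuation K Γ → Set (c₀ ⊔ ℓ₀ ⊔ c' ⊔ ℓ₁)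
TrivialOn {K₀ = K₀} {Γ = Γ} E val =
  ∀ a → ¬ (a ≈₀ 0₀) → v (ι a) ≈∞ just (OrderedAbelianGroup.0# Γ)
  where
    open Field K₀ renaming (_≈_ to _≈₀_; 0# to 0₀) using ()
    open Extension E
    open Valuation val
    open Extended Γ

module FieldSum {c ℓ} (K : Field c ℓ) where
  open Field K

  ∑ : ∀ {n} → (Fin n → Carrier) → Carrier
  ∑ {ℕ.zero}  f = 0#
  ∑ {ℕ.suc n} f = f fzero + ∑ (λ i → f (fsuc i))

Matrix : ∀ {c ℓ} → Field c ℓ → ℕ → Set c
Matrix K n = Fin n → Fin n → Field.Carrier K

_⊗_ : ∀ {c ℓ} {K : Field c ℓ} {n} → Matrix K n → Matrix K n → Matrix K n
_⊗_ {K = K} A B i j = ∑ λ k → A i k * B k j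
  where open Field K
        open FieldSum K

identity : ∀ {c ℓ} (K : Field c ℓ) n → Matrix K n
identity K n i j with i Data.Fin.≟ j
... | Relation.Nullary.yes _ = Field.1# K
... | Relation.Nullary.no  _ = Field.0# K

IsInvertible : ∀ {c ℓ} (K : Field c ℓ) n → Matrix K n → Set (c ⊔ ℓ)
IsInvertible K n μ = Σ (Matrix K n) λ ν →
  (∀ i j → (_⊗_ {K = K} μ ν) i j ≈ identity K n i j) ×
  (∀ i j → (_⊗_ {K = K} ν μ) i j ≈ identity K n i j)
  where open Field K

act : ∀ {c₀ ℓ₀ c ℓ} {K₀ : Field c₀ ℓ₀} {K : Field c ℓ} {n} →
      Extension K₀ K → Matrix K₀ n → (Fin n → Field.Carrier K) →
      Fin n → Field.Carrier K
act {K = K} E μ x j = ∑ λ k → ι (μ j k) * x k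
  where open Field K
        open FieldSum K
        open Extension E

module Submission where

-- A valuation trivial on K₀ satisfies v (c w) = v w for every nonzero c ∈ K₀. For p, q ∈ K and
-- distinct a, b ∈ K₀ the differences (p + a q) − (p + b q) = (a − b) q and
-- b (p + a q) − a (p + b q) = (b − a) p show, by the ultrametric inequality, that
-- v (p + c q) ≤ min (v p, v q) holds for c = a or for c = b. So each valuation excludes at most one c,
-- and since K₀ is infinite some c works for all m valuations at once. Choosing the coefficients aₖ one
-- at a time in this way, y₀ = x₀ + Σₖ aₖ xₖ has valuation at most that of every xₖ; choosing then bⱼ with
-- v (xⱼ + bⱼ y₀) ≤ v y₀, the ultrametric inequality forces equality. The change of coordinates
-- x ↦ (y₀, xⱼ + bⱼ y₀) is invertible over K₀.

open import Defs
open import Level using (Level; _⊔_)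
open import Data.Nat using (ℕ; zero; suc)
open import Data.Fin using (Fin; _≟_; punchIn; toℕ) renaming (zero to fzero; suc to fsuc)
open import Data.Fin.Properties using (punchInᵢ≢i; punchIn-injective; suc-injective; toℕ-injective)
open import Data.Vec.Functional using (_∷_; tail)
open import Data.Maybe using (just; nothing)
open import Data.Product using (Σ; ∃; _×_; _,_; proj₁; proj₂)
import Data.Product as Product
open import Data.Sum using (_⊎_; inj₁; inj₂; map)
open import Function using (id)
open import Relation.Nullary using (¬_; Dec; yes; no; contradiction)
open import Relation.Unary using (Pred)
open import Relation.Binary.Core using (Rel)
open import Relation.Binary.PropositionalEquality using (_≡_; _≢_; cong; subst; subst₂)
  renaming (refl to ≡-refl; sym to ≡-sym; trans to ≡-trans)
open import Relation.Binary.Structures using (IsTotalOrder)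
import Relation.Binary.Reasoning.Setoid as SetoidReasoning
open import Algebra.Structures using (IsAbelianGroup)
open import Algebra.Morphism.Structures using (module IsRingHomomorphism)
import Algebra.Properties.Group as GroupProperties
import Algebra.Properties.Ring as RingProperties
import Algebra.Solver.Ring.NaturalCoefficients.Default as NaturalSolver

module ExtendedOrder {c ℓ₁ ℓ₂} (Γ : OrderedAbelianGroup c ℓ₁ ℓ₂) where
  open OrderedAbelianGroup Γ
  open Extended Γ
  private
    module O = IsTotalOrder isTotalOrder
    module G = IsAbelianGroup isAbelianGroup

  ≈∞-sym : ∀ {x y} → x ≈∞ y → y ≈∞ x
  ≈∞-sym ∞≈∞     = ∞≈∞
  ≈∞-sym (fin e) = fin (O.Eq.sym e)

  ≈∞-trans : ∀ {x y z} → x ≈∞ y → y ≈∞ z → x ≈∞ z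
  ≈∞-trans ∞≈∞     ∞≈∞     = ∞≈∞
  ≈∞-trans (fin e) (fin f) = fin (O.Eq.trans e f)

  ≤∞-reflexive : ∀ {x y} → x ≈∞ y → x ≤∞ y
  ≤∞-reflexive ∞≈∞     = ≤∞-top
  ≤∞-reflexive (fin e) = fin (O.reflexive e)

  ≤∞-trans : ∀ {x y z} → x ≤∞ y → y ≤∞ z → x ≤∞ z
  ≤∞-trans _       ≤∞-top  = ≤∞-top
  ≤∞-trans (fin p) (fin q) = fin (O.trans p q)

  ≤∞-antisym : ∀ {x y} → x ≤∞ y → y ≤∞ x → x ≈∞ y
  ≤∞-antisym ≤∞-top  ≤∞-top  = ∞≈∞
  ≤∞-antisym (fin p) (fin q) = fin (O.antisym p q)

  ≤∞-total : ∀ x y → x ≤∞ y ⊎ y ≤∞ x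
  ≤∞-total _        nothing  = inj₁ ≤∞-top
  ≤∞-total nothing  (just b) = inj₂ ≤∞-top
  ≤∞-total (just a) (just b) with O.total a b
  ... | inj₁ a≤b = inj₁ (fin a≤b)
  ... | inj₂ b≤a = inj₂ (fin b≤a)

  +∞-identityˡ : ∀ {x} y → x ≈∞ just 0# → (x +∞ y) ≈∞ y
  +∞-identityˡ nothing  (fin _)   = ∞≈∞
  +∞-identityˡ (just b) (fin a≈0) =
    fin (O.Eq.trans (G.∙-congʳ a≈0) (G.identityˡ b))

module _ {a r q : Level} {A : Set a} (_#_ : Rel A r) where

  allButOne : (Q : Pred A q) → (∀ {x y} → x # y → Q x ⊎ Q y) →
              ∀ n (g : Fin (suc n) → A) → (∀ {i j} → i ≢ j → g i # g j) →
              ∃ λ e → ∀ i → i ≢ e → Q (g i)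
  allButOne Q one-of zero    g apart = fzero , λ { fzero i≢0 → contradiction ≡-refl i≢0 }
  allButOne Q one-of (suc n) g apart
    with allButOne Q one-of n (λ i → g (fsuc i)) (λ i≢j → apart (λ e → i≢j (suc-injective e)))
  ... | e , rest with one-of (apart {fzero} {fsuc e} λ ())
  ... | inj₁ Q0 = fsuc e , λ { fzero _ → Q0 ; (fsuc i) i≢e → rest i (λ eq → i≢e (cong fsuc eq)) }
  ... | inj₂ Qe = fzero , λ { fzero 0≢0 → contradiction ≡-refl 0≢0
                            ; (fsuc i) _ → rest-or-e i }
    where
    rest-or-e : ∀ i → Q (g (fsuc i))
    rest-or-e i with i ≟ e
    ... | yes ≡-refl = Qe
    ... | no i≢e   = rest i i≢e

  commonWitness : ∀ m (P : Fin m → Pred A q) → (∀ k {x y} → x # y → P k x ⊎ P k y) →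
                  (g : Fin (suc m) → A) → (∀ {i j} → i ≢ j → g i # g j) →
                  ∃ λ i → ∀ k → P k (g i)
  commonWitness zero    P one-of g apart = fzero , λ ()
  commonWitness (suc m) P one-of g apart
    with allButOne (P fzero) (one-of fzero) (suc m) g apart
  ... | e , P0 with commonWitness m (λ k → P (fsuc k)) (λ k → one-of (fsuc k))
                      (λ i → g (punchIn e i)) (λ i≢j → apart (λ eq → i≢j (punchIn-injective e _ _ eq)))
  ... | i , Ps = punchIn e i , λ { fzero → P0 (punchIn e i) (punchInᵢ≢i e i) ; (fsuc k) → Ps k }

infinite-commonWitness : ∀ {c ℓ q} (F : Field c ℓ) → Infinite F →
  ∀ m (P : Fin m → Pred (Field.Carrier F) q) →
  (∀ k {a b} → ¬ (Field._≈_ F a b) → P k a ⊎ P k b) → ∃ λ a → ∀ k → P k a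
infinite-commonWitness F (f , f-injective) m P one-of =
  Product.map (λ i → f (toℕ i)) id
    (commonWitness (λ a b → ¬ (Field._≈_ F a b)) m P one-of (λ i → f (toℕ i))
       (λ i≢j fi≈fj → i≢j (toℕ-injective (f-injective _ _ fi≈fj))))

module _ {c ℓ} (F : Field c ℓ) where
  open Field F

  apart⇒offset : ∀ {a b} → ¬ (a ≈ b) → ∃ λ e → ¬ (e ≈ 0#) × a ≈ b + e
  apart⇒offset {a} {b} a≉b = - b + a , e≉0 , sym (\\-leftDividesˡ b a)
    where
    open GroupProperties +-group using (\\-leftDividesˡ)
    e≉0 : ¬ (- b + a ≈ 0#)
    e≉0 e≈0 = a≉b (trans (sym (\\-leftDividesˡ b a)) (trans (+-congˡ e≈0) (+-identityʳ b)))

module TrivialValuation {c₀ ℓ₀ c ℓ c' ℓ₁ ℓ₂} {K₀ : Field c₀ ℓ₀} {K : Field c ℓ}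
  (E : Extension K₀ K) {Γ : OrderedAbelianGroup c' ℓ₁ ℓ₂}
  (V : Valuation K Γ) (triv : TrivialOn E V) where
  private module K₀ = Field K₀
  open Field K
  open Extension E
  open IsRingHomomorphism isHom
  open Valuation V
  open Extended Γ
  open ExtendedOrder Γ
  open SetoidReasoning setoid
  open NaturalSolver commutativeSemiring

  v-ι*-≈ : ∀ {c} w → ¬ (c K₀.≈ K₀.0#) → v (ι c * w) ≈∞ v w
  v-ι*-≈ {c} w c≉0 = ≈∞-trans (v-* (ι c) w) (+∞-identityˡ (v w) (triv c c≉0))

  -- c ≈ 0 is not decidable, so split on v (ι c) instead: a finite value forces c ≉ 0.
  v-≤-ι* : ∀ c w → v w ≤∞ v (ι c * w)
  v-≤-ι* c w with v (ι c) in vιc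
  ... | nothing =
    ≤∞-trans ≤∞-top (≤∞-reflexive (≈∞-sym (subst (λ u → v (ι c * w) ≈∞ (u +∞ v w)) vιc (v-* (ι c) w))))
  ... | just _  = ≤∞-reflexive (≈∞-sym (v-ι*-≈ w c≉0))
    where
    c≉0 : ¬ (c K₀.≈ K₀.0#)
    c≉0 c≈0 with subst₂ _≈∞_ vιc v-0 (v-cong (trans (⟦⟧-cong c≈0) 0#-homo))
    ... | ()

  v-difference : ∀ {u w z} → u ≈ w + z → v u ≤∞ v z ⊎ v w ≤∞ v z
  v-difference {u} {w} {z} u≈w+z =
    map v≤vz (λ r → v≤vz (≤∞-trans (v-≤-ι* (K₀.- K₀.1#) w) r))
        (v-+ u (ι (K₀.- K₀.1#) * w))
    where
    z≈ : u + ι (K₀.- K₀.1#) * w ≈ z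
    z≈ = begin
      u + ι (K₀.- K₀.1#) * w  ≈⟨ +-congˡ (*-congʳ (trans (-‿homo K₀.1#) (-‿cong 1#-homo))) ⟩
      u + - 1# * w            ≈⟨ +-congˡ (RingProperties.-1*x≈-x ring w) ⟩
      u + - w                 ≈⟨ GroupProperties.x≈z//y +-group z w u (trans (+-comm z w) (sym u≈w+z)) ⟨
      z                       ∎
    v≤vz : ∀ {x} → x ≤∞ v (u + ι (K₀.- K₀.1#) * w) → x ≤∞ v z
    v≤vz r = ≤∞-trans r (≤∞-reflexive (v-cong z≈))

  v-≤-vq-one-of : ∀ p q {a b} → ¬ (a K₀.≈ b) → v (p + ι a * q) ≤∞ v q ⊎ v (p + ι b * q) ≤∞ v q
  v-≤-vq-one-of p q {a} {b} a≉b with apart⇒offset K₀ a≉b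
  ... | e , e≉0 , a≈b+e = map to-vq to-vq (v-difference split)
    where
    split : p + ι a * q ≈ (p + ι b * q) + ι e * q
    split = begin
      p + ι a * q                ≈⟨ +-congˡ (*-congʳ (trans (⟦⟧-cong a≈b+e) (+-homo b e))) ⟩
      p + (ι b + ι e) * q        ≈⟨ solve 4 (λ p q B E → p :+ (B :+ E) :* q := (p :+ B :* q) :+ E :* q) refl p q (ι b) (ι e) ⟩
      (p + ι b * q) + ι e * q    ∎
    to-vq : ∀ {x} → x ≤∞ v (ι e * q) → x ≤∞ v q
    to-vq r = ≤∞-trans r (≤∞-reflexive (v-ι*-≈ q e≉0))

  v-≤-vp-one-of : ∀ p q {a b} → ¬ (a K₀.≈ b) → v (p + ι a * q) ≤∞ v p ⊎ v (p + ι b * q) ≤∞ v p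
  v-≤-vp-one-of p q {a} {b} a≉b with apart⇒offset K₀ (λ b≈a → a≉b (K₀.sym b≈a))
  ... | e , e≉0 , b≈a+e =
    map (λ r → ≤∞-trans (v-≤-ι* b _) (to-vp r)) (λ r → ≤∞-trans (v-≤-ι* a _) (to-vp r)) (v-difference split)
    where
    split : ι b * (p + ι a * q) ≈ ι a * (p + ι b * q) + ι e * p
    split = begin
      ι b * (p + ι a * q)              ≈⟨ solve 4 (λ p q A B → B :* (p :+ A :* q) := B :* p :+ A :* (B :* q)) refl p q (ι a) (ι b) ⟩
      ι b * p + ι a * (ι b * q)        ≈⟨ +-congʳ (*-congʳ (trans (⟦⟧-cong b≈a+e) (+-homo a e))) ⟩
      (ι a + ι e) * p + ι a * (ι b * q) ≈⟨ solve 5 (λ p q A B E → (A :+ E) :* p :+ A :* (B :* q) := A :* (p :+ B :* q) :+ E :* p) refl p q (ι a) (ι b) (ι e) ⟩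
      ι a * (p + ι b * q) + ι e * p    ∎
    to-vp : ∀ {x} → x ≤∞ v (ι e * p) → x ≤∞ v p
    to-vp r = ≤∞-trans r (≤∞-reflexive (v-ι*-≈ p e≉0))

  AtMostMin : Carrier → Carrier → K₀.Carrier → Set (c' ⊔ ℓ₂)
  AtMostMin p q a = v (p + ι a * q) ≤∞ v p × v (p + ι a * q) ≤∞ v q

  atMostMin-one-of : ∀ p q {a b} → ¬ (a K₀.≈ b) → AtMostMin p q a ⊎ AtMostMin p q b
  atMostMin-one-of p q a≉b with ≤∞-total (v p) (v q)
  ... | inj₁ vp≤vq = map (λ r → r , ≤∞-trans r vp≤vq) (λ r → r , ≤∞-trans r vp≤vq) (v-≤-vp-one-of p q a≉b)
  ... | inj₂ vq≤vp = map (λ r → ≤∞-trans r vq≤vp , r) (λ r → ≤∞-trans r vq≤vp , r) (v-≤-vq-one-of p q a≉b)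

  v-+-ι*-≈ : ∀ {p q} b → v q ≤∞ v p → v (p + ι b * q) ≤∞ v q → v (p + ι b * q) ≈∞ v q
  v-+-ι*-≈ {p} {q} b vq≤vp ≤vq with v-+ p (ι b * q)
  ... | inj₁ vp≤ = ≤∞-antisym ≤vq (≤∞-trans vq≤vp vp≤)
  ... | inj₂ vbq≤ = ≤∞-antisym ≤vq (≤∞-trans (v-≤-ι* b q) vbq≤)

module MatrixAlgebra {c ℓ} (F : Field c ℓ) where
  open Field F
  open FieldSum F
  open SetoidReasoning setoid
  open NaturalSolver commutativeSemiring

  identity-diag : ∀ {n} (i : Fin n) → identity F n i i ≡ 1#
  identity-diag i with i ≟ i
  ... | yes _  = ≡-refl
  ... | no i≢i = contradiction ≡-refl i≢i

  identity-offdiag : ∀ {n} {i j : Fin n} → i ≢ j → identity F n i j ≡ 0#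
  identity-offdiag {i = i} {j} i≢j with i ≟ j
  ... | yes i≡j = contradiction i≡j i≢j
  ... | no _    = ≡-refl

  identity-sym : ∀ {n} (i j : Fin n) → identity F n i j ≡ identity F n j i
  identity-sym i j = by-cases (i ≟ j)
    where
    by-cases : Dec (i ≡ j) → identity F _ i j ≡ identity F _ j i
    by-cases (yes ≡-refl) = ≡-refl
    by-cases (no i≢j)     = ≡-trans (identity-offdiag i≢j) (≡-sym (identity-offdiag (λ j≡i → i≢j (≡-sym j≡i))))

  identity-suc : ∀ {n} (i j : Fin n) → identity F (suc n) (fsuc i) (fsuc j) ≡ identity F n i j
  identity-suc i j = by-cases (i ≟ j)
    where
    by-cases : Dec (i ≡ j) → identity F _ (fsuc i) (fsuc j) ≡ identity F _ i j
    by-cases (yes ≡-refl) = ≡-trans (identity-diag (fsuc i)) (≡-sym (identity-diag i))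
    by-cases (no i≢j)     = ≡-trans (identity-offdiag (λ e → i≢j (suc-injective e))) (≡-sym (identity-offdiag i≢j))

  ≡⇒≈ : ∀ {x y} → x ≡ y → x ≈ y
  ≡⇒≈ ≡-refl = refl

  ∑-cong : ∀ {n} {f g : Fin n → Carrier} → (∀ i → f i ≈ g i) → ∑ f ≈ ∑ g
  ∑-cong {zero}  f≈g = refl
  ∑-cong {suc n} f≈g = +-cong (f≈g fzero) (∑-cong (λ i → f≈g (fsuc i)))

  ∑-zero : ∀ {n} (f : Fin n → Carrier) → (∀ i → f i ≈ 0#) → ∑ f ≈ 0#
  ∑-zero {zero}  f f≈0 = refl
  ∑-zero {suc n} f f≈0 = trans (+-cong (f≈0 fzero) (∑-zero _ (λ i → f≈0 (fsuc i)))) (+-identityʳ 0#)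

  ∑-single : ∀ {n} (f : Fin n → Carrier) j → (∀ i → i ≢ j → f i ≈ 0#) → ∑ f ≈ f j
  ∑-single {suc n} f fzero    f≈0 =
    trans (+-congˡ (∑-zero _ (λ i → f≈0 (fsuc i) λ ()))) (+-identityʳ _)
  ∑-single {suc n} f (fsuc j) f≈0 =
    trans (+-cong (f≈0 fzero λ ()) (∑-single _ j (λ i i≢j → f≈0 (fsuc i) λ e → i≢j (suc-injective e))))
          (+-identityˡ _)

  ∑-+ : ∀ {n} (f g : Fin n → Carrier) → ∑ (λ i → f i + g i) ≈ ∑ f + ∑ g
  ∑-+ {zero}  f g = sym (+-identityˡ 0#)
  ∑-+ {suc n} f g = begin
    (f fzero + g fzero) + ∑ (λ i → f (fsuc i) + g (fsuc i))
      ≈⟨ +-congˡ (∑-+ (λ i → f (fsuc i)) (λ i → g (fsuc i))) ⟩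
    (f fzero + g fzero) + (∑ (λ i → f (fsuc i)) + ∑ (λ i → g (fsuc i)))
      ≈⟨ solve 4 (λ a b c d → (a :+ b) :+ (c :+ d) := (a :+ c) :+ (b :+ d)) refl _ _ _ _ ⟩
    (f fzero + ∑ (λ i → f (fsuc i))) + (g fzero + ∑ (λ i → g (fsuc i))) ∎

  *-distribˡ-∑ : ∀ {n} x (f : Fin n → Carrier) → ∑ (λ i → x * f i) ≈ x * ∑ f
  *-distribˡ-∑ {zero}  x f = sym (zeroʳ x)
  *-distribˡ-∑ {suc n} x f = trans (+-congˡ (*-distribˡ-∑ x (λ i → f (fsuc i)))) (sym (distribˡ x _ _))

  ∑-identityˡ : ∀ {n} j (w : Fin n → Carrier) → ∑ (λ l → identity F n j l * w l) ≈ w j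
  ∑-identityˡ j w =
    trans (∑-single _ j (λ l l≢j → trans (*-congʳ (≡⇒≈ (identity-offdiag λ j≡l → l≢j (≡-sym j≡l)))) (zeroˡ _)))
          (trans (*-congʳ (≡⇒≈ (identity-diag j))) (*-identityˡ _))

  ∑-identityʳ : ∀ {n} k (w : Fin n → Carrier) → ∑ (λ l → w l * identity F n l k) ≈ w k
  ∑-identityʳ k w =
    trans (∑-single _ k (λ l l≢k → trans (*-congˡ (≡⇒≈ (identity-offdiag l≢k))) (zeroʳ _)))
          (trans (*-congˡ (≡⇒≈ (identity-diag k))) (*-identityʳ _))

  ∑-identity+outer : ∀ {n} j x (a w : Fin n → Carrier) →
                     ∑ (λ l → (identity F n j l + x * a l) * w l) ≈ w j + x * ∑ (λ l → a l * w l)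
  ∑-identity+outer {n} j x a w = begin
    ∑ (λ l → (identity F _ j l + x * a l) * w l)
      ≈⟨ ∑-cong (λ l → solve 4 (λ d x a w → (d :+ x :* a) :* w := d :* w :+ x :* (a :* w)) refl _ x (a l) (w l)) ⟩
    ∑ (λ l → identity F _ j l * w l + x * (a l * w l))
      ≈⟨ ∑-+ {n} _ _ ⟩
    ∑ (λ l → identity F _ j l * w l) + ∑ (λ l → x * (a l * w l))
      ≈⟨ +-cong (∑-identityˡ j w) (*-distribˡ-∑ {n} x _) ⟩
    w j + x * ∑ (λ l → a l * w l) ∎

module Mixing {c ℓ} (F : Field c ℓ) {n : ℕ} where
  open Field F
  open FieldSum F
  open MatrixAlgebra F
  open SetoidReasoning setoid
  open NaturalSolver commutativeSemiring

  -- mixing a b = [[1, 0], [b, I]] · [[1, aᵀ], [0, I]], a product of two block transvections;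
  -- mixing⁻¹ a b is the product of their inverses in the opposite order.
  mixing : (a b : Fin n → Carrier) → Matrix F (suc n)
  mixing a b fzero    fzero    = 1#
  mixing a b fzero    (fsuc k) = a k
  mixing a b (fsuc j) fzero    = b j
  mixing a b (fsuc j) (fsuc k) = identity F n j k + b j * a k

  dot : (a b : Fin n → Carrier) → Carrier
  dot a b = ∑ (λ l → a l * b l)

  mixing⁻¹ : (a b : Fin n → Carrier) → Matrix F (suc n)
  mixing⁻¹ a b fzero    fzero    = 1# + dot a b
  mixing⁻¹ a b fzero    (fsuc k) = - a k
  mixing⁻¹ a b (fsuc j) fzero    = - b j
  mixing⁻¹ a b (fsuc j) (fsuc k) = identity F n j k

  dot-inverseʳ : (a b : Fin n → Carrier) → dot a b + dot a (λ l → - b l) ≈ 0#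
  dot-inverseʳ a b = trans (sym (∑-+ {n} _ _))
    (∑-zero _ (λ l → trans (sym (distribˡ (a l) _ _)) (trans (*-congˡ (-‿inverseʳ (b l))) (zeroʳ _))))

  mixing-rightInverse : ∀ a b i j → (_⊗_ {K = F} (mixing a b) (mixing⁻¹ a b)) i j ≈ identity F (suc n) i j
  mixing-rightInverse a b fzero fzero = begin
    1# * (1# + dot a b) + dot a -b  ≈⟨ solve 2 (λ S T → con 1 :* (con 1 :+ S) :+ T := con 1 :+ (S :+ T)) refl _ _ ⟩
    1# + (dot a b + dot a -b)       ≈⟨ +-congˡ (dot-inverseʳ a b) ⟩
    1# + 0#                         ≈⟨ +-identityʳ 1# ⟩
    1#                              ∎
    where
    -b : Fin n → Carrier
    -b l = - b l
  mixing-rightInverse a b fzero (fsuc k) =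
    trans (+-cong (*-identityˡ (- a k)) (∑-identityʳ k a)) (-‿inverseˡ (a k))
  mixing-rightInverse a b (fsuc j) fzero = begin
    b j * (1# + dot a b) + ∑ (λ l → (identity F n j l + b j * a l) * -b l)
      ≈⟨ +-congˡ (∑-identity+outer j (b j) a -b) ⟩
    b j * (1# + dot a b) + (- b j + b j * dot a -b)
      ≈⟨ solve 4 (λ B S nB T → B :* (con 1 :+ S) :+ (nB :+ B :* T) := (B :+ nB) :+ B :* (S :+ T)) refl (b j) _ (- b j) _ ⟩
    (b j + - b j) + b j * (dot a b + dot a -b)
      ≈⟨ +-cong (-‿inverseʳ (b j)) (trans (*-congˡ (dot-inverseʳ a b)) (zeroʳ (b j))) ⟩
    0# + 0#
      ≈⟨ +-identityʳ 0# ⟩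
    0# ∎
    where
    -b : Fin n → Carrier
    -b l = - b l
  mixing-rightInverse a b (fsuc j) (fsuc k) = begin
    b j * - a k + ∑ (λ l → (identity F n j l + b j * a l) * identity F n l k)
      ≈⟨ +-congˡ (∑-identityʳ k (λ l → identity F n j l + b j * a l)) ⟩
    b j * - a k + (identity F n j k + b j * a k)
      ≈⟨ solve 4 (λ B nA d A → B :* nA :+ (d :+ B :* A) := d :+ B :* (A :+ nA)) refl (b j) (- a k) _ (a k) ⟩
    identity F n j k + b j * (a k + - a k)
      ≈⟨ +-congˡ (trans (*-congˡ (-‿inverseʳ (a k))) (zeroʳ (b j))) ⟩
    identity F n j k + 0#
      ≈⟨ +-identityʳ _ ⟩
    identity F n j k
      ≡⟨ ≡-sym (identity-suc j k) ⟩
    identity F (suc n) (fsuc j) (fsuc k) ∎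

  mixing-transpose : ∀ a b j k → mixing a b j k ≈ mixing b a k j
  mixing-transpose a b fzero    fzero    = refl
  mixing-transpose a b fzero    (fsuc k) = refl
  mixing-transpose a b (fsuc j) fzero    = refl
  mixing-transpose a b (fsuc j) (fsuc k) = +-cong (≡⇒≈ (identity-sym j k)) (*-comm (b j) (a k))

  mixing⁻¹-transpose : ∀ a b j k → mixing⁻¹ a b j k ≈ mixing⁻¹ b a k j
  mixing⁻¹-transpose a b fzero    fzero    = +-congˡ (∑-cong (λ l → *-comm (a l) (b l)))
  mixing⁻¹-transpose a b fzero    (fsuc k) = refl
  mixing⁻¹-transpose a b (fsuc j) fzero    = refl
  mixing⁻¹-transpose a b (fsuc j) (fsuc k) = ≡⇒≈ (identity-sym j k)

  -- Transposition swaps the roles of a and b, so the left inverse follows from the right one.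
  mixing-leftInverse : ∀ a b i j → (_⊗_ {K = F} (mixing⁻¹ a b) (mixing a b)) i j ≈ identity F (suc n) i j
  mixing-leftInverse a b i j = begin
    ∑ (λ k → mixing⁻¹ a b i k * mixing a b k j)
      ≈⟨ ∑-cong (λ k → trans (*-comm _ _) (*-cong (mixing-transpose a b k j) (mixing⁻¹-transpose a b i k))) ⟩
    ∑ (λ k → mixing b a j k * mixing⁻¹ b a k i)
      ≈⟨ mixing-rightInverse b a j i ⟩
    identity F (suc n) j i
      ≡⟨ identity-sym j i ⟩
    identity F (suc n) i j ∎

  mixing-invertible : ∀ a b → IsInvertible F (suc n) (mixing a b)
  mixing-invertible a b = mixing⁻¹ a b , mixing-rightInverse a b , mixing-leftInverse a b

combination : ∀ {c₀ ℓ₀ c ℓ} {K₀ : Field c₀ ℓ₀} {K : Field c ℓ} → Extension K₀ K → ∀ {n} →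
              Field.Carrier K → (Fin n → Field.Carrier K₀) → (Fin n → Field.Carrier K) → Field.Carrier K
combination {K = K} E p a x = p + ∑ (λ k → ι (a k) * x k)
  where open Field K
        open FieldSum K
        open Extension E

module MixingAction {c₀ ℓ₀ c ℓ} {K₀ : Field c₀ ℓ₀} {K : Field c ℓ} (E : Extension K₀ K) {n : ℕ} where
  private module K₀ = Field K₀
  open Field K
  open FieldSum K
  open MatrixAlgebra K
  open Mixing K₀ {n} using (mixing)
  open Extension E
  open IsRingHomomorphism isHom
  open SetoidReasoning setoid
  open NaturalSolver commutativeSemiring

  ι-identity : ∀ j k → ι (identity K₀ n j k) ≈ identity K n j k
  ι-identity j k with j ≟ k
  ... | yes _ = 1#-homo
  ... | no _  = 0#-homo

  act-mixing-zero : ∀ a b (x : Fin (suc n) → Carrier) →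
                    act E (mixing a b) x fzero ≈ combination E (x fzero) a (tail x)
  act-mixing-zero a b x = +-congʳ (trans (*-congʳ 1#-homo) (*-identityˡ _))

  act-mixing-suc : ∀ a b (x : Fin (suc n) → Carrier) j →
                   act E (mixing a b) x (fsuc j) ≈ x (fsuc j) + ι (b j) * combination E (x fzero) a (tail x)
  act-mixing-suc a b x j = begin
    ι (b j) * x fzero + ∑ (λ k → ι (identity K₀ n j k K₀.+ b j K₀.* a k) * x (fsuc k))
      ≈⟨ +-congˡ (∑-cong (λ k → *-congʳ (trans (+-homo _ _) (+-cong (ι-identity j k) (*-homo (b j) (a k)))))) ⟩
    ι (b j) * x fzero + ∑ (λ k → (identity K n j k + ι (b j) * ι (a k)) * x (fsuc k))
      ≈⟨ +-congˡ (∑-identity+outer j (ι (b j)) (λ k → ι (a k)) (λ k → x (fsuc k))) ⟩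
    ι (b j) * x fzero + (x (fsuc j) + ι (b j) * ∑ (λ k → ι (a k) * x (fsuc k)))
      ≈⟨ solve 4 (λ B x₀ xⱼ s → B :* x₀ :+ (xⱼ :+ B :* s) := xⱼ :+ B :* (x₀ :+ s)) refl (ι (b j)) (x fzero) (x (fsuc j)) _ ⟩
    x (fsuc j) + ι (b j) * (x fzero + ∑ (λ k → ι (a k) * x (fsuc k))) ∎

module Scrambling {c₀ ℓ₀ c ℓ c' ℓ₁ ℓ₂} {K₀ : Field c₀ ℓ₀} {K : Field c ℓ} (inf : Infinite K₀)
  (E : Extension K₀ K) {m : ℕ} {Γ : Fin m → OrderedAbelianGroup c' ℓ₁ ℓ₂}
  (val : (i : Fin m) → Valuation K (Γ i)) (triv : ∀ i → TrivialOn E (val i)) where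
  open Field K
  open Extension E
  module V i = TrivialValuation E (val i) (triv i)
  private module O i = ExtendedOrder (Γ i)

  _≼⟨_⟩_ : Carrier → Fin m → Carrier → Set (c' ⊔ ℓ₂)
  x ≼⟨ i ⟩ y = Extended._≤∞_ (Γ i) (Valuation.v (val i) x) (Valuation.v (val i) y)

  _≃⟨_⟩_ : Carrier → Fin m → Carrier → Set (c' ⊔ ℓ₁)
  x ≃⟨ i ⟩ y = Extended._≈∞_ (Γ i) (Valuation.v (val i) x) (Valuation.v (val i) y)

  ≼-trans : ∀ {i x y z} → x ≼⟨ i ⟩ y → y ≼⟨ i ⟩ z → x ≼⟨ i ⟩ z
  ≼-trans {i} = O.≤∞-trans i

  ≈⇒≃ : ∀ {i x y} → x ≈ y → x ≃⟨ i ⟩ y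
  ≈⇒≃ {i} = Valuation.v-cong (val i)

  ≃-trans : ∀ {i x y z} → x ≃⟨ i ⟩ y → y ≃⟨ i ⟩ z → x ≃⟨ i ⟩ z
  ≃-trans {i} = O.≈∞-trans i

  ≃-sym : ∀ {i x y} → x ≃⟨ i ⟩ y → y ≃⟨ i ⟩ x
  ≃-sym {i} = O.≈∞-sym i

  atMostMin-everywhere : ∀ p q → ∃ λ a → ∀ i → V.AtMostMin i p q a
  atMostMin-everywhere p q =
    infinite-commonWitness K₀ inf m (λ i → V.AtMostMin i p q) (λ i → V.atMostMin-one-of i p q)

  minimal-combination : ∀ {n} p (x : Fin n → Carrier) → ∃ λ a → ∀ i →
    combination E p a x ≼⟨ i ⟩ p × (∀ k → combination E p a x ≼⟨ i ⟩ x k)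
  minimal-combination {zero} p x =
    (λ ()) , λ i → O.≤∞-reflexive i (≈⇒≃ (+-identityʳ p)) , λ ()
  minimal-combination {suc n} p x with atMostMin-everywhere p (x fzero)
  ... | a₀ , a₀-min with minimal-combination (p + ι a₀ * x fzero) (tail x)
  ... | a , a-min = a₀ ∷ a , λ i →
    let y≼y₁ = O.≤∞-reflexive i (≈⇒≃ (sym (+-assoc p _ _)))
        (y₁≼p₁ , y₁≼x) = a-min i
        (p₁≼p , p₁≼x₀) = a₀-min i
    in ≼-trans y≼y₁ (≼-trans y₁≼p₁ p₁≼p) ,
       λ { fzero → ≼-trans y≼y₁ (≼-trans y₁≼p₁ p₁≼x₀) ; (fsuc k) → ≼-trans y≼y₁ (y₁≼x k) }

lemma3p2 : ∀ {c₀ ℓ₀ c ℓ c' ℓ₁ ℓ₂}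
    (K₀ : Field c₀ ℓ₀) (K : Field c ℓ) → Infinite K₀ →
    (E : Extension K₀ K) →
    (m : ℕ) (Γ : Fin m → OrderedAbelianGroup c' ℓ₁ ℓ₂)
    (val : (i : Fin m) → Valuation K (Γ i)) →
    (∀ i → TrivialOn E (val i)) →
    (n : ℕ) (x : Fin n → Field.Carrier K) →
    Σ (Matrix K₀ n) λ μ → IsInvertible K₀ n μ ×
      (∀ i j k → Extended._≈∞_ (Γ i) (Valuation.v (val i) (act E μ x j))
                                     (Valuation.v (val i) (act E μ x k)))
lemma3p2 K₀ K inf E m Γ val triv zero    x = (λ ()) , ((λ ()) , (λ ()) , (λ ())) , λ i ()
lemma3p2 K₀ K inf E m Γ val triv (suc n) x =
  mixing a b , mixing-invertible a b , λ i j k → ≃-trans (≃y₀ i j) (≃-sym (≃y₀ i k))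
  where
  open Scrambling inf E val triv
  open Mixing K₀ {n}
  open MixingAction E {n}

  a : Fin n → Field.Carrier K₀
  a = proj₁ (minimal-combination (x fzero) (tail x))

  y₀ : Field.Carrier K
  y₀ = combination E (x fzero) a (tail x)

  y₀-minimal : ∀ i → y₀ ≼⟨ i ⟩ x fzero × (∀ k → y₀ ≼⟨ i ⟩ x (fsuc k))
  y₀-minimal = proj₂ (minimal-combination (x fzero) (tail x))

  b-choice : ∀ j → ∃ λ c → ∀ i → V.AtMostMin i (x (fsuc j)) y₀ c
  b-choice j = atMostMin-everywhere (x (fsuc j)) y₀

  b : Fin n → Field.Carrier K₀
  b j = proj₁ (b-choice j)

  ≃y₀ : ∀ i j → act E (mixing a b) x j ≃⟨ i ⟩ y₀
  ≃y₀ i fzero    = ≈⇒≃ (act-mixing-zero a b x)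
  ≃y₀ i (fsuc j) = ≃-trans (≈⇒≃ (act-mixing-suc a b x j))
    (V.v-+-ι*-≈ i (b j) (proj₂ (y₀-minimal i) j) (proj₂ (proj₂ (b-choice j) i)))
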